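{- For all $r\geq 2$, $1\leq \ell\leq k-1$, and $1\leq m <\frac{k}{k-\ell}$, \[ \hat{R}_r(P_{\ell+(m+1)(k-\ell)}^{(k,\ell)}) \leq \hat{R}_r(P_{2m(k-\ell)}^{(m(k-\ell),(m-1)(k-\ell))}) \leq \hat{R}_r(P_{2m}^{(m)}) \leq (e(m+1)r)^m. \] In particular (when $m=1$), $\hat{R}_r(P^{(k,\ell)}_{2k-\ell})=r+1$.
   Context: A $k$-graph is a $k$-uniform hypergraph. For hypergraphs $G,H$ and an integer $r\ge 1$, $G\to_r H$ means that every $r$-coloring of the edges of $G$ contains a monochromatic copy of $H$; for a $k$-graph $H$, $\hat R_r(H)$ is the minimum number of edges of a $k$-graph $G$ with $G\to_r H$. For $k\ge1$, $0\le \ell\le k-1$ and $m\ge 1$, the $(k,\ell)$-path with $m$ edges is the $k$-graph with vertex set $\{v_1,\dots,v_{k+(m-1)(k-\ell)}\}$ and edges $\{v_{(i-1)(k-\ell)+1},\dots,v_{(i-1)(k-\ell)+k}\}$ for $i\in[m]$; $P_n^{(k,\ell)}$ denotes the $(k,\ell)$-path with $n$ vertices, and $P_n^{(k)}:=P_n^{(k,k-1)}$ (tight path). -}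

module Defs where

open import Data.Nat using (ℕ; zero; suc; _+_; _*_; _∸_; _^_; _≤_; _≤ᵇ_; _<ᵇ_)
open import Data.Nat.Properties using (m^n≢0)
open import Data.Bool using (_∧_)
open import Data.Fin using (Fin; toℕ)
open import Data.Fin.Subset using (Subset; _∈_; ∣_∣)
open import Data.Vec using (tabulate)
open import Data.Product using (Σ; ∃; ∃-syntax; _×_)
open import Data.Integer using (+_)
open import Data.Rational as ℚ using (ℚ; _/_)
open import Function.Bundles using (_⇔_)
open import Function.Definitions using (Injective)
open import Relation.Binary.PropositionalEquality using (_≡_)

record Hypergraph : Set where
  field
    nV : ℕ
    nE : ℕ
    edge : Fin nE → Subset nV
open Hypergraph public

IsKGraph : ℕ → Hypergraph → Set
IsKGraph k G = (∀ i → ∣ edge G i ∣ ≡ k) × (∀ i j → edge G i ≡ edge G j → i ≡ j)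

Colouring : ℕ → Hypergraph → Set
Colouring r G = Fin (nE G) → Fin r

MonoCopy : ∀ {r} (G H : Hypergraph) → Colouring r G → Set
MonoCopy G H c =
  Σ (Fin (nV H) → Fin (nV G)) λ φ → Injective _≡_ _≡_ φ ×
  Σ (Fin (nE H) → Fin (nE G)) λ ψ →
    (∀ e x → (x ∈ edge G (ψ e)) ⇔ (∃[ y ] (y ∈ edge H e × φ y ≡ x))) ×
    (∀ e e′ → c (ψ e) ≡ c (ψ e′))

Arrows : ℕ → Hypergraph → Hypergraph → Set
Arrows r G H = (c : Colouring r G) → MonoCopy G H c

-- R̂_r(H) ≤ N  (minimum taken over k-graphs G)
SizeRamsey≤ : (r k : ℕ) → Hypergraph → ℕ → Set
SizeRamsey≤ r k H N = ∃[ G ] (IsKGraph k G × nE G ≤ N × Arrows r G H)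

SizeRamsey≥ : (r k : ℕ) → Hypergraph → ℕ → Set
SizeRamsey≥ r k H N = ∀ G → IsKGraph k G → Arrows r G H → N ≤ nE G

-- R̂_r(H) ≤ R̂_r(H′), where H is a k-graph and H′ a k′-graph:
-- for every k′-graph G with G →_r H′ there is a k-graph G′ with
-- at most as many edges and G′ →_r H.
SizeRamseyMono : (r k : ℕ) → Hypergraph → (k′ : ℕ) → Hypergraph → Set
SizeRamseyMono r k H k′ H′ =
  ∀ G → IsKGraph k′ G → Arrows r G H′ →
  ∃[ G′ ] (IsKGraph k G′ × nE G′ ≤ nE G × Arrows r G′ H)

-- The (k,ℓ)-path with t edges (t ≥ 1): vertices 0 … k+(t-1)(k-ℓ)-1 (0-indexed),
-- the i-th edge (i = 0 … t-1) is {i(k-ℓ), …, i(k-ℓ)+k-1}.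
Path : (k ℓ t : ℕ) → Hypergraph
Path k ℓ t = record
  { nV = k + (t ∸ 1) * (k ∸ ℓ)
  ; nE = t
  ; edge = λ i → tabulate λ x →
      ((toℕ i * (k ∸ ℓ)) ≤ᵇ toℕ x) ∧ (toℕ x <ᵇ (toℕ i * (k ∸ ℓ) + k))
  }

-- Lower approximations of e^m: a_N = (1 + 1/(N+1))^((N+1) m), increasing with
-- supremum e^m.
expApprox : (m N : ℕ) → ℚ
expApprox m N = (+ (suc (suc N) ^ (suc N * m))) / (suc N ^ (suc N * m))
  where instance _ = m^n≢0 (suc N) (suc N * m)

-- E ≤ c · e^m  (E, c natural numbers), expressed as
-- E ≤ c · sup_N a_N, i.e. for every rational ε > 0 some N has E ≤ c·a_N + ε.
≤c·e^ : (E c m : ℕ) → Set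
≤c·e^ E c m = ∀ (ε : ℚ) → ℚ.0ℚ ℚ.< ε →
  ∃[ N ] ((+ E / 1) ℚ.≤ ((+ c / 1) ℚ.* expApprox m N) ℚ.+ ε)

-- R̂_r(H) ≤ (e c)^m = c^m e^m for H a k-graph
SizeRamsey≤e : (r k : ℕ) → Hypergraph → (c m : ℕ) → Set
SizeRamsey≤e r k H c m = ∃[ G ] (IsKGraph k G × Arrows r G H × ≤c·e^ (nE G) (c ^ m) m)

{-# OPTIONS --safe #-}
module Submission where

-- Write D = k − ℓ. Adding the same k − mD new vertices to every edge of an mD-graph turns a copy of
-- the (mD, (m−1)D)-path with m + 1 edges into a copy of the (k, ℓ)-path with m + 1 edges (the new
-- vertices fill the middle part shared by all of its edges), and blowing every vertex of an m-graph up
-- into D copies turns a tight path into an (mD, (m−1)D)-path; neither changes the edges or their colours.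
--
-- The complete m-partite m-graph with parts of size n = mr + 1 arrows the tight path with m + 1 edges.
-- Some colour class S of transversals has n|S| > m n^m. Discarding the tuples that are alone in their
-- column (fixing all coordinates but the first) loses at most n^(m−1) of them, so by induction on m there
-- are tuples a, b differing in every coordinate such that all m + 1 tuples obtained from a by switching its
-- coordinates one after the other to those of b lie in S: these transversals form a tight path. Its
-- n^m ≤ ((m+1)r)^m edges give the third bound, even without the factor e^m.
--
-- For m = 1 this gives r + 1 edges; with at most r edges a rainbow colouring exists, and a monochromatic
-- path would have to map both of its edges onto the same edge.

open import Defs

open import Data.Bool using (Bool; true; false; _∧_; T)
import Data.Bool.Properties as Bool
open import Data.Bool.Properties using (T-≡; T-∧)
open import Data.Fin
  using (Fin; toℕ; fromℕ<; inject≤; splitAt; join; cast; combine; remQuot; finToFun; funToFin; _↑ˡ_; _↑ʳ_)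
import Data.Fin as Fin
import Data.Fin.Properties as FinP
open import Data.Fin.Properties
  using ( toℕ<n; toℕ-fromℕ<; toℕ-injective; inject≤-injective; any?
        ; splitAt-↑ˡ; splitAt-↑ʳ; splitAt⁻¹-↑ˡ; splitAt⁻¹-↑ʳ; splitAt-join; join-splitAt
        ; toℕ-↑ˡ; toℕ-↑ʳ; ↑ˡ-injective; ↑ʳ-injective; toℕ-cast; cast-involutive
        ; toℕ-combine; remQuot-combine; combine-remQuot; combine-injective
        ; funToFin-finToFin; finToFun-funToFin )
open import Data.Fin.Subset using (Subset; _∈_; ∣_∣; ⁅_⁆)
open import Data.Fin.Subset.Properties
  using (∣⊤∣≡n; ∣⊥∣≡0; ∣⁅x⁆∣≡1; x∈⁅x⁆; x∈⁅y⁆⇒x≡y; x∈⁅y⁆⇔x≡y)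
import Data.Integer as ℤ
import Data.Integer.Properties as ℤ
open import Data.Nat using (ℕ; zero; suc; _+_; _*_; _∸_; _^_; _≤_; _<_; _≤ᵇ_; _≤?_; _<?_; z≤n; s≤s; NonZero; >-nonZero)
open import Data.Nat.Coprimality using (1-coprimeTo)
import Data.Nat.Coprimality as Coprime
open import Data.Nat.Properties
open import Data.Nat.Tactic.RingSolver using (solve-∀)
open import Algebra.Properties.CommutativeSemigroup +-commutativeSemigroup using (xy∙z≈xz∙y)
open import Algebra.Properties.Semiring.Sum +-*-semiring
  using (sum; sum-syntax; sum-cong-≗; ∑-distrib-+; ∑-comm; *-distribˡ-sum)
open import Data.Product using (∃; ∃₂; ∃-syntax; _×_; _,_; proj₁; proj₂)
open import Data.Product.Function.NonDependent.Propositional using (_×-⇔_)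
open import Data.Rational using (_/_; mkℚ)
import Data.Rational as ℚ
import Data.Rational.Properties as ℚ
open import Data.Sum using (_⊎_; inj₁; inj₂)
open import Data.Vec using (Vec; tabulate; lookup; _∷_; []; _++_; replicate)
open import Data.Vec.Properties
  using ( []=⇒lookup; lookup⇒[]=; lookup∘tabulate; tabulate-cong; tabulate∘lookup
        ; lookup-++ˡ; lookup-++ʳ; lookup-replicate; ∷-injectiveˡ; ++-injectiveˡ; ++-injectiveʳ )
open import Function using (_∘_)
open import Function.Bundles using (_⇔_; Equivalence; mk⇔)
open import Function.Definitions using (Injective)
open import Function.Properties.Equivalence using () renaming (sym to ⇔-sym; trans to ⇔-trans)
open import Relation.Binary.PropositionalEquality
open import Relation.Nullary using (¬_; ¬?; yes; no; contradiction; _×-dec_)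
open import Relation.Nullary.Decidable using (⌊_⌋; toWitness)

∈-cong-lookup : ∀ {m n} {p : Subset m} {q : Subset n} {x y} → lookup p x ≡ lookup q y → x ∈ p ⇔ y ∈ q
∈-cong-lookup eq = mk⇔
  (λ x∈ → lookup⇒[]= _ _ (trans (sym eq) ([]=⇒lookup x∈)))
  (λ y∈ → lookup⇒[]= _ _ (trans eq ([]=⇒lookup y∈)))

∈-tabulate⇔ : ∀ {n} (f : Fin n → Bool) x → x ∈ tabulate f ⇔ T (f x)
∈-tabulate⇔ f x = mk⇔
  (λ x∈ → Equivalence.from T-≡ (trans (sym (lookup∘tabulate f x)) ([]=⇒lookup x∈)))
  (λ fx → lookup⇒[]= x _ (trans (lookup∘tabulate f x) (Equivalence.to T-≡ fx)))

∣p++q∣≡∣p∣+∣q∣ : ∀ {m n} (p : Subset m) (q : Subset n) → ∣ p ++ q ∣ ≡ ∣ p ∣ + ∣ q ∣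
∣p++q∣≡∣p∣+∣q∣ [] q = refl
∣p++q∣≡∣p∣+∣q∣ (true ∷ p) q = cong suc (∣p++q∣≡∣p∣+∣q∣ p q)
∣p++q∣≡∣p∣+∣q∣ (false ∷ p) q = ∣p++q∣≡∣p∣+∣q∣ p q

↑ˡ≢↑ʳ : ∀ {m} n (i : Fin m) (j : Fin n) → i ↑ˡ n ≢ m ↑ʳ j
↑ˡ≢↑ʳ {m} n i j eq with trans (sym (splitAt-↑ˡ m i n)) (trans (cong (splitAt m) eq) (splitAt-↑ʳ m n j))
... | ()

↑-cases : ∀ m n (x : Fin (m + n)) → (∃[ i ] i ↑ˡ n ≡ x) ⊎ (∃[ j ] m ↑ʳ j ≡ x)
↑-cases m n x with splitAt m x in eq
... | inj₁ i = inj₁ (i , splitAt⁻¹-↑ˡ eq)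
... | inj₂ j = inj₂ (j , splitAt⁻¹-↑ʳ eq)

toℕ≤n : ∀ {n} (i : Fin (n + 1)) → toℕ i ≤ n
toℕ≤n {n} i = ≤-pred (subst (toℕ i <_) (+-comm n 1) (toℕ<n i))

funToFin-cong : ∀ {m n} {f g : Fin m → Fin n} → (∀ i → f i ≡ g i) → funToFin f ≡ funToFin g
funToFin-cong {zero}  _   = refl
funToFin-cong {suc m} f≗g = cong₂ combine (f≗g Fin.zero) (funToFin-cong (f≗g ∘ Fin.suc))

∧≡true : ∀ {a b} → a ∧ b ≡ true → a ≡ true × b ≡ true
∧≡true {true} {true} _ = refl , refl

hypergraph : ∀ {n t} → (Fin t → Subset n) → Hypergraph
hypergraph {n} {t} edges = record { nV = n ; nE = t ; edge = edges }

mapEdges : (G : Hypergraph) {N : ℕ} → (Subset (nV G) → Subset N) → Hypergraph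
mapEdges G f = hypergraph (f ∘ edge G)

mapEdges-isKGraph : ∀ {G N k k′} (f : Subset (nV G) → Subset N) →
  (∀ p → ∣ p ∣ ≡ k → ∣ f p ∣ ≡ k′) → Injective _≡_ _≡_ f →
  IsKGraph k G → IsKGraph k′ (mapEdges G f)
mapEdges-isKGraph f resize f-inj (sizes , distinct) =
  (λ i → resize _ (sizes i)) , (λ i j eq → distinct i j (f-inj eq))

MapsOnto : ∀ {m n} → (Fin m → Fin n) → Subset m → Subset n → Set
MapsOnto φ p q = ∀ x → x ∈ q ⇔ (∃[ y ] (y ∈ p × φ y ≡ x))

HasIntervalEdges : ∀ {n t} → (Fin t → Subset n) → (lo hi : Fin t → ℕ) → Set
HasIntervalEdges {n} {t} edges lo hi =
  ∀ e (x : Fin n) → x ∈ edges e ⇔ (lo e ≤ toℕ x × toℕ x < hi e)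

HasIntervalEdges-cong : ∀ {n t} {E : Fin t → Subset n} {lo lo′ hi hi′ : Fin t → ℕ} →
  (∀ e → lo e ≡ lo′ e) → (∀ e → hi e ≡ hi′ e) → HasIntervalEdges E lo hi → HasIntervalEdges E lo′ hi′
HasIntervalEdges-cong {E = E} lo≗lo′ hi≗hi′ intervals e x =
  subst₂ (λ l h → x ∈ E e ⇔ (l ≤ toℕ x × toℕ x < h)) (lo≗lo′ e) (hi≗hi′ e) (intervals e x)

Path-hasIntervalEdges : ∀ k ℓ t {D} → k ∸ ℓ ≡ D →
  HasIntervalEdges (edge (Path k ℓ t)) (λ e → toℕ e * D) (λ e → toℕ e * D + k)
Path-hasIntervalEdges k ℓ t refl e x = mk⇔
  (λ x∈ → let lo , hi = Equivalence.to T-∧ (Equivalence.to (∈-tabulate⇔ _ x) x∈)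
          in ≤ᵇ⇒≤ _ _ lo , <ᵇ⇒< _ _ hi)
  (λ (lo , hi) → Equivalence.from (∈-tabulate⇔ _ x) (Equivalence.from T-∧ (≤⇒≤ᵇ lo , <⇒<ᵇ hi)))

-- Adding common vertices to all edges

extend : Hypergraph → ℕ → Hypergraph
extend G c = mapEdges G (_++ replicate c true)

extend-isKGraph : ∀ {k G} c → IsKGraph k G → IsKGraph (k + c) (extend G c)
extend-isKGraph c = mapEdges-isKGraph _
  (λ p ∣p∣≡k → trans (∣p++q∣≡∣p∣+∣q∣ p _) (cong₂ _+_ ∣p∣≡k (∣⊤∣≡n c)))
  (λ {p} {q} → ++-injectiveˡ p q)

module Extension {t nT nH : ℕ} (K c : ℕ) (a : Fin t → ℕ) (a≤K : ∀ e → a e ≤ K) (K≤nT : K ≤ nT)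
  (nH≡nT+c : nH ≡ nT + c) {eT : Fin t → Subset nT} {eH : Fin t → Subset nH}
  (eT-intervals : HasIntervalEdges eT a (λ e → a e + K))
  (eH-intervals : HasIntervalEdges eH a (λ e → a e + K + c)) where

  -- A vertex v of the longer path goes to φ v left of the block [K, K + c), to a new vertex inside it
  -- and to φ (v − c) right of it; every edge contains the whole block since it starts at a e ≤ K.
  data Region (v : ℕ) : Set where
    left   : (u : Fin nT) → toℕ u ≡ v → v < K → Region v
    middle : (j : Fin c) → K + toℕ j ≡ v → Region v
    right  : (u : Fin nT) → toℕ u + c ≡ v → K + c ≤ v → Region v

  region : ∀ v → v < nH → Region v
  region v v<nH with v <? K | v <? K + c
  ... | yes v<K | _ = left (fromℕ< (<-≤-trans v<K K≤nT)) (toℕ-fromℕ< _) v<K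
  ... | no v≮K | yes v<K+c = middle (fromℕ< v∸K<c) (trans (cong (K +_) (toℕ-fromℕ< _)) (m+[n∸m]≡n K≤v))
    where
    K≤v = ≮⇒≥ v≮K
    v∸K<c : v ∸ K < c
    v∸K<c = +-cancelˡ-< K _ _ (subst (_< K + c) (sym (m+[n∸m]≡n K≤v)) v<K+c)
  ... | no _ | no v≮K+c = right (fromℕ< v∸c<nT) (trans (cong (_+ c) (toℕ-fromℕ< _)) (m∸n+n≡m c≤v)) K+c≤v
    where
    K+c≤v = ≮⇒≥ v≮K+c
    c≤v = ≤-trans (m≤n+m c K) K+c≤v
    v∸c<nT : v ∸ c < nT
    v∸c<nT = +-cancelʳ-< c _ _ (subst₂ _<_ (sym (m∸n+n≡m c≤v)) nH≡nT+c v<nH)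

  module _ {N} (φ : Fin nT → Fin N) where

    image : ∀ {v} → Region v → Fin (N + c)
    image (left u _ _)  = φ u ↑ˡ c
    image (middle j _)  = N ↑ʳ j
    image (right u _ _) = φ u ↑ˡ c

    image-unique : ∀ {v} (p q : Region v) → image p ≡ image q
    image-unique (left u eq _) (left u′ eq′ _) = cong (λ w → φ w ↑ˡ c) (toℕ-injective (trans eq (sym eq′)))
    image-unique (left _ _ v<K) (middle _ eq′) = contradiction (subst (K ≤_) eq′ (m≤m+n K _)) (<⇒≱ v<K)
    image-unique (left _ _ v<K) (right _ _ K+c≤v) = contradiction (≤-trans (m≤m+n K c) K+c≤v) (<⇒≱ v<K)
    image-unique (middle _ eq) (left _ _ v<K) = contradiction (subst (K ≤_) eq (m≤m+n K _)) (<⇒≱ v<K)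
    image-unique (middle j eq) (middle j′ eq′) = cong (N ↑ʳ_) (toℕ-injective (+-cancelˡ-≡ K _ _ (trans eq (sym eq′))))
    image-unique (middle j eq) (right _ _ K+c≤v) = contradiction (subst (_< K + c) eq (+-monoʳ-< K (toℕ<n j))) (≤⇒≯ K+c≤v)
    image-unique (right _ _ K+c≤v) (left _ _ v<K) = contradiction (≤-trans (m≤m+n K c) K+c≤v) (<⇒≱ v<K)
    image-unique (right _ _ K+c≤v) (middle j eq′) = contradiction (subst (_< K + c) eq′ (+-monoʳ-< K (toℕ<n j))) (≤⇒≯ K+c≤v)
    image-unique (right u eq _) (right u′ eq′ _) = cong (λ w → φ w ↑ˡ c) (toℕ-injective (+-cancelʳ-≡ c _ _ (trans eq (sym eq′))))

    image-unique′ : ∀ {v w} → v ≡ w → (p : Region v) (q : Region w) → image p ≡ image q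
    image-unique′ refl = image-unique

    image-injective : Injective _≡_ _≡_ φ → ∀ {v w} (p : Region v) (q : Region w) → image p ≡ image q → v ≡ w
    image-injective φ-inj (left u eq _) (left u′ eq′ _) im≡ = trans (sym eq) (trans (cong toℕ (φ-inj (↑ˡ-injective c _ _ im≡))) eq′)
    image-injective φ-inj (left _ _ _) (middle _ _) im≡ = contradiction im≡ (↑ˡ≢↑ʳ c _ _)
    image-injective φ-inj (left u eq v<K) (right u′ eq′ K+c≤w) im≡ =
      contradiction (subst (_< K) (trans (sym eq) (cong toℕ (φ-inj (↑ˡ-injective c _ _ im≡)))) v<K)
                    (≤⇒≯ (+-cancelʳ-≤ c _ _ (subst (K + c ≤_) (sym eq′) K+c≤w)))
    image-injective φ-inj (middle _ _) (left _ _ _) im≡ = contradiction (sym im≡) (↑ˡ≢↑ʳ c _ _)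
    image-injective φ-inj (middle j eq) (middle j′ eq′) im≡ = trans (sym eq) (trans (cong (λ i → K + toℕ i) (↑ʳ-injective N _ _ im≡)) eq′)
    image-injective φ-inj (middle _ _) (right _ _ _) im≡ = contradiction (sym im≡) (↑ˡ≢↑ʳ c _ _)
    image-injective φ-inj (right u eq K+c≤v) (left u′ eq′ w<K) im≡ =
      sym (image-injective φ-inj (left u′ eq′ w<K) (right u eq K+c≤v) (sym im≡))
    image-injective φ-inj (right _ _ _) (middle _ _) im≡ = contradiction im≡ (↑ˡ≢↑ʳ c _ _)
    image-injective φ-inj (right u eq _) (right u′ eq′ _) im≡ =
      trans (sym eq) (trans (cong (λ i → toℕ i + c) (φ-inj (↑ˡ-injective c _ _ im≡))) eq′)

    extendVertex : Fin nH → Fin (N + c)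
    extendVertex y = image (region (toℕ y) (toℕ<n y))

    extendVertex-injective : Injective _≡_ _≡_ φ → Injective _≡_ _≡_ extendVertex
    extendVertex-injective φ-inj {x} {y} im≡ =
      toℕ-injective (image-injective φ-inj (region (toℕ x) (toℕ<n x)) (region (toℕ y) (toℕ<n y)) im≡)

    private
      nT≤nH : nT ≤ nH
      nT≤nH = subst (nT ≤_) (sym nH≡nT+c) (m≤m+n nT c)

      reach : ∀ e {v} (p : Region v) → v < nH → a e ≤ v → v < a e + K + c →
            ∃[ y ] (y ∈ eH e × extendVertex y ≡ image p)
      reach e {v} p v<nH lo hi =
        y , Equivalence.from (eH-intervals e y) (subst (a e ≤_) (sym y≡v) lo , subst (_< a e + K + c) (sym y≡v) hi) ,
        image-unique′ y≡v (region (toℕ y) (toℕ<n y)) p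
        where
        y = fromℕ< v<nH
        y≡v : toℕ y ≡ v
        y≡v = toℕ-fromℕ< v<nH

    extend-mapsOnto : ∀ {e q} → MapsOnto φ (eT e) q → MapsOnto extendVertex (eH e) (q ++ replicate c true)
    extend-mapsOnto {e} {q} onto x = mk⇔ (to x) (from x)
      where
      φu∈q : ∀ {u} → u ∈ eT e → φ u ∈ q
      φu∈q u∈ = Equivalence.from (onto _) (_ , u∈ , refl)

      ↑ˡ∈⇔ : ∀ w → w ↑ˡ c ∈ q ++ replicate c true ⇔ w ∈ q
      ↑ˡ∈⇔ w = ∈-cong-lookup (lookup-++ˡ q _ w)

      reach-↑ˡ : ∀ w → w ∈ q → ∃[ y ] (y ∈ eH e × extendVertex y ≡ w ↑ˡ c)
      reach-↑ˡ w w∈ with Equivalence.to (onto w) w∈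
      ... | u , u∈ , refl with Equivalence.to (eT-intervals e u) u∈ | toℕ u <? K
      ... | lo , _ | yes u<K = reach e (left u refl u<K) (<-≤-trans (toℕ<n u) nT≤nH)
        lo (<-≤-trans u<K (≤-trans (m≤n+m K (a e)) (m≤m+n _ c)))
      ... | lo , hi | no u≮K = reach e (right u refl (+-monoˡ-≤ c (≮⇒≥ u≮K)))
        (subst (toℕ u + c <_) (sym nH≡nT+c) (+-monoˡ-< c (toℕ<n u))) (≤-trans lo (m≤m+n _ c)) (+-monoˡ-< c hi)

      reach-↑ʳ : ∀ j → ∃[ y ] (y ∈ eH e × extendVertex y ≡ N ↑ʳ j)
      reach-↑ʳ j = reach e (middle j refl)
        (subst (K + toℕ j <_) (sym nH≡nT+c) (<-≤-trans K+j<K+c (+-monoˡ-≤ c K≤nT)))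
        (≤-trans (a≤K e) (m≤m+n K _)) (<-≤-trans K+j<K+c (+-monoˡ-≤ c (m≤n+m K (a e))))
        where
        K+j<K+c : K + toℕ j < K + c
        K+j<K+c = +-monoʳ-< K (toℕ<n j)

      to : ∀ x → x ∈ q ++ replicate c true → ∃[ y ] (y ∈ eH e × extendVertex y ≡ x)
      to x x∈ with ↑-cases N c x
      ... | inj₁ (w , refl) = reach-↑ˡ w (Equivalence.to (↑ˡ∈⇔ w) x∈)
      ... | inj₂ (j , refl) = reach-↑ʳ j

      image-∈ : ∀ {v} (p : Region v) → a e ≤ v × v < a e + K + c → image p ∈ q ++ replicate c true
      image-∈ (left u refl u<K) (lo , _) = Equivalence.from (↑ˡ∈⇔ (φ u))
        (φu∈q (Equivalence.from (eT-intervals e u) (lo , <-≤-trans u<K (m≤n+m K (a e)))))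
      image-∈ (middle j _) _ = lookup⇒[]= _ _ (trans (lookup-++ʳ q _ j) (lookup-replicate j true))
      image-∈ (right u refl K+c≤v) (_ , hi) = Equivalence.from (↑ˡ∈⇔ (φ u))
        (φu∈q (Equivalence.from (eT-intervals e u) (≤-trans (a≤K e) (+-cancelʳ-≤ c _ _ K+c≤v) , +-cancelʳ-< c _ _ hi)))

      from : ∀ x → ∃[ y ] (y ∈ eH e × extendVertex y ≡ x) → x ∈ q ++ replicate c true
      from _ (y , y∈ , refl) = image-∈ (region (toℕ y) (toℕ<n y)) (Equivalence.to (eH-intervals e y) y∈)

  extend-copy : ∀ {r} G (col : Colouring r G) → MonoCopy G (hypergraph eT) col → MonoCopy (extend G c) (hypergraph eH) col
  extend-copy G col (φ , φ-inj , ψ , onto , mono) =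
    extendVertex φ , extendVertex-injective φ φ-inj , ψ , (λ e → extend-mapsOnto φ (onto e)) , mono

sizeRamseyMono-extend : ∀ r k ℓ m → 1 ≤ m → m * (k ∸ ℓ) < k →
  SizeRamseyMono r k (Path k ℓ (m + 1)) (m * (k ∸ ℓ)) (Path (m * (k ∸ ℓ)) ((m ∸ 1) * (k ∸ ℓ)) (m + 1))
sizeRamseyMono-extend r k ℓ m@(suc m′) _ K<k G G-isK G→T =
  extend G c , subst (λ k′ → IsKGraph k′ (extend G c)) K+c≡k (extend-isKGraph c G-isK) , ≤-refl ,
  λ col → extend-copy G col (G→T col)
  where
  D = k ∸ ℓ
  K = m * D
  c = k ∸ K
  M = (m + 1) ∸ 1
  K+c≡k : K + c ≡ k
  K+c≡k = m+[n∸m]≡n (<⇒≤ K<k)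
  step : K ∸ m′ * D ≡ D
  step = m+n∸n≡m D (m′ * D)
  nH≡nT+c : k + M * D ≡ K + M * (K ∸ m′ * D) + c
  nH≡nT+c = begin
    k + M * D            ≡⟨ cong (_+ M * D) (sym K+c≡k) ⟩
    K + c + M * D        ≡⟨ xy∙z≈xz∙y K c (M * D) ⟩
    K + M * D + c        ≡⟨ cong (λ d → K + M * d + c) (sym step) ⟩
    K + M * (K ∸ m′ * D) + c ∎
    where open ≡-Reasoning
  open Extension K c (λ e → toℕ e * D) (λ e → *-monoˡ-≤ D (toℕ≤n e)) (m≤m+n K _) nH≡nT+c
    (Path-hasIntervalEdges K (m′ * D) (m + 1) step)
    (HasIntervalEdges-cong (λ _ → refl) (λ e → trans (cong (toℕ e * D +_) (sym K+c≡k)) (sym (+-assoc (toℕ e * D) K c)))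
      (Path-hasIntervalEdges k ℓ (m + 1) refl))

-- Blowing up vertices

scaled-≤⇔ : ∀ {d s} lo u → s < d → lo ≤ u ⇔ d * lo ≤ d * u + s
scaled-≤⇔ {d} {s} lo u s<d = mk⇔
  (λ lo≤u → ≤-trans (*-monoʳ-≤ d lo≤u) (m≤m+n _ s))
  (λ dlo≤du+s → ≮⇒≥ λ u<lo → <⇒≱ (<-≤-trans (+-monoʳ-< (d * u) s<d)
    (subst (_≤ d * lo) (trans (*-suc d u) (+-comm d (d * u))) (*-monoʳ-≤ d u<lo))) dlo≤du+s)

scaled-<⇔ : ∀ {d s} u hi → s < d → u < hi ⇔ d * u + s < d * hi
scaled-<⇔ u hi s<d = mk⇔
  (λ u<hi → ≰⇒> λ dhi≤du+s → <⇒≱ u<hi (Equivalence.from (scaled-≤⇔ hi u s<d) dhi≤du+s))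
  (λ du+s<dhi → ≰⇒> λ hi≤u → <⇒≱ du+s<dhi (Equivalence.to (scaled-≤⇔ hi u s<d) hi≤u))

blow : ∀ {N} d → Subset N → Subset (N * d)
blow d []      = []
blow d (b ∷ p) = replicate d b ++ blow d p

lookup-blow : ∀ {N} d (p : Subset N) i j → lookup (blow d p) (combine i j) ≡ lookup p i
lookup-blow d (b ∷ p) Fin.zero    j = trans (lookup-++ˡ (replicate d b) (blow d p) j) (lookup-replicate j b)
lookup-blow d (b ∷ p) (Fin.suc i) j = trans (lookup-++ʳ (replicate d b) (blow d p) (combine i j)) (lookup-blow d p i j)

combine∈blow⇔ : ∀ {N} d (p : Subset N) i j → combine i j ∈ blow d p ⇔ i ∈ p
combine∈blow⇔ d p i j = ∈-cong-lookup (lookup-blow d p i j)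

∣blow∣ : ∀ {N} d (p : Subset N) → ∣ blow d p ∣ ≡ ∣ p ∣ * d
∣blow∣ d [] = refl
∣blow∣ d (true ∷ p) = trans (∣p++q∣≡∣p∣+∣q∣ (replicate d true) (blow d p)) (cong₂ _+_ (∣⊤∣≡n d) (∣blow∣ d p))
∣blow∣ d (false ∷ p) = trans (∣p++q∣≡∣p∣+∣q∣ (replicate d false) (blow d p)) (cong₂ _+_ (∣⊥∣≡0 d) (∣blow∣ d p))

blow-injective : ∀ {N} d → Injective _≡_ _≡_ (blow {N} (suc d))
blow-injective d {[]} {[]} _ = refl
blow-injective d {b ∷ p} {b′ ∷ q} eq = cong₂ _∷_
  (∷-injectiveˡ (++-injectiveˡ (replicate (suc d) b) (replicate (suc d) b′) eq))
  (blow-injective d (++-injectiveʳ (replicate (suc d) b) (replicate (suc d) b′) eq))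

blowUp : Hypergraph → ℕ → Hypergraph
blowUp G d = mapEdges G (blow d)

blowUp-isKGraph : ∀ {k G} d → IsKGraph k G → IsKGraph (k * suc d) (blowUp G (suc d))
blowUp-isKGraph d = mapEdges-isKGraph _ (λ p ∣p∣≡k → trans (∣blow∣ (suc d) p) (cong (_* suc d) ∣p∣≡k)) (blow-injective d)

module BlowUp {t nT nH : ℕ} (d : ℕ) (nH≡nT*d : nH ≡ nT * d) {lo hi : Fin t → ℕ}
  {eT : Fin t → Subset nT} {eH : Fin t → Subset nH}
  (eT-intervals : HasIntervalEdges eT lo hi)
  (eH-intervals : HasIntervalEdges eH (λ e → d * lo e) (λ e → d * hi e)) where

  unsplit : Fin nT → Fin d → Fin nH
  unsplit u s = cast (sym nH≡nT*d) (combine u s)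

  split : Fin nH → Fin nT × Fin d
  split y = remQuot d (cast nH≡nT*d y)

  split-unsplit : ∀ u s → split (unsplit u s) ≡ (u , s)
  split-unsplit u s = trans (cong (remQuot d) (cast-involutive nH≡nT*d (sym nH≡nT*d) (combine u s))) (remQuot-combine u s)

  toℕ-split : ∀ y → let (u , s) = split y in toℕ y ≡ d * toℕ u + toℕ s
  toℕ-split y = trans (sym (toℕ-cast nH≡nT*d y))
    (trans (cong toℕ (sym (combine-remQuot {nT} d (cast nH≡nT*d y)))) (toℕ-combine (proj₁ (split y)) (proj₂ (split y))))

  ∈eH⇔ : ∀ e y → y ∈ eH e ⇔ proj₁ (split y) ∈ eT e
  ∈eH⇔ e y =
    ⇔-trans (eH-intervals e y)
      (⇔-trans (subst (λ n → (d * lo e ≤ n × n < d * hi e) ⇔ (lo e ≤ toℕ u × toℕ u < hi e)) (sym (toℕ-split y))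
                      (⇔-sym (scaled-≤⇔ (lo e) (toℕ u) (toℕ<n s) ×-⇔ scaled-<⇔ (toℕ u) (hi e) (toℕ<n s))))
               (⇔-sym (eT-intervals e u)))
    where
    u = proj₁ (split y)
    s = proj₂ (split y)

  split-injective : Injective _≡_ _≡_ split
  split-injective {y} {y′} eq = toℕ-injective (trans (toℕ-split y)
    (trans (cong (λ (u , s) → d * toℕ u + toℕ s) eq) (sym (toℕ-split y′))))

  module _ {N} (φ : Fin nT → Fin N) where

    blowVertex : Fin nH → Fin (N * d)
    blowVertex y = combine (φ (proj₁ (split y))) (proj₂ (split y))

    blowVertex-injective : Injective _≡_ _≡_ φ → Injective _≡_ _≡_ blowVertex
    blowVertex-injective φ-inj eq with combine-injective _ _ _ _ eq
    ... | φu≡φu′ , s≡s′ = split-injective (cong₂ _,_ (φ-inj φu≡φu′) s≡s′)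

    blow-mapsOnto : ∀ {e q} → MapsOnto φ (eT e) q → MapsOnto blowVertex (eH e) (blow d q)
    blow-mapsOnto {e} {q} onto x = mk⇔ to from
      where
      w = proj₁ (remQuot {N} d x)
      s = proj₂ (remQuot {N} d x)
      combine-w-s≡x : combine w s ≡ x
      combine-w-s≡x = combine-remQuot {N} d x

      to : x ∈ blow d q → ∃[ y ] (y ∈ eH e × blowVertex y ≡ x)
      to x∈ with Equivalence.to (onto w) (Equivalence.to (combine∈blow⇔ d q w s) (subst (_∈ blow d q) (sym combine-w-s≡x) x∈))
      ... | u , u∈ , φu≡w =
        unsplit u s ,
        Equivalence.from (∈eH⇔ e _) (subst (_∈ eT e) (sym (cong proj₁ (split-unsplit u s))) u∈) ,
        trans (cong (λ (u′ , s′) → combine (φ u′) s′) (split-unsplit u s)) (trans (cong (λ w′ → combine w′ s) φu≡w) combine-w-s≡x)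

      from : ∃[ y ] (y ∈ eH e × blowVertex y ≡ x) → x ∈ blow d q
      from (y , y∈ , refl) = Equivalence.from (combine∈blow⇔ d q _ _)
        (Equivalence.from (onto _) (_ , Equivalence.to (∈eH⇔ e y) y∈ , refl))

  blowUp-copy : ∀ {r} G (col : Colouring r G) → MonoCopy G (hypergraph eT) col → MonoCopy (blowUp G d) (hypergraph eH) col
  blowUp-copy G col (φ , φ-inj , ψ , onto , mono) =
    blowVertex φ , blowVertex-injective φ φ-inj , ψ , (λ e → blow-mapsOnto φ (onto e)) , mono

sizeRamseyMono-blowUp : ∀ r m d → 1 ≤ m → 1 ≤ d →
  SizeRamseyMono r (m * d) (Path (m * d) ((m ∸ 1) * d) (m + 1)) m (Path m (m ∸ 1) (m + 1))
sizeRamseyMono-blowUp r m@(suc m′) d@(suc d′) _ _ G G-isK G→T =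
  blowUp G d , blowUp-isKGraph d′ G-isK , ≤-refl , λ col → blowUp-copy G col (G→T col)
  where
  distrib : ∀ a b d → a * d + b * d ≡ (a + b * 1) * d
  distrib = solve-∀
  scale : ∀ a d → a * d ≡ d * (a * 1)
  scale = solve-∀
  scale-shift : ∀ a b d → a * d + b * d ≡ d * (a * 1 + b)
  scale-shift = solve-∀
  M = (m + 1) ∸ 1
  unit-step : m ∸ m′ ≡ 1
  unit-step = m+n∸n≡m 1 m′
  step : m * d ∸ m′ * d ≡ d
  step = m+n∸n≡m d (m′ * d)
  nH≡nT*d : m * d + M * (m * d ∸ m′ * d) ≡ (m + M * (m ∸ m′)) * d
  nH≡nT*d = begin
    m * d + M * (m * d ∸ m′ * d) ≡⟨ cong (λ s → m * d + M * s) step ⟩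
    m * d + M * d                ≡⟨ distrib m M d ⟩
    (m + M * 1) * d              ≡⟨ cong (λ s → (m + M * s) * d) (sym unit-step) ⟩
    (m + M * (m ∸ m′)) * d       ∎
    where open ≡-Reasoning
  lo≗ : ∀ (e : Fin (m + 1)) → toℕ e * d ≡ d * (toℕ e * 1)
  lo≗ e = scale (toℕ e) d
  hi≗ : ∀ (e : Fin (m + 1)) → toℕ e * d + m * d ≡ d * (toℕ e * 1 + m)
  hi≗ e = scale-shift (toℕ e) m d
  open BlowUp d nH≡nT*d (Path-hasIntervalEdges m m′ (m + 1) unit-step)
    (HasIntervalEdges-cong lo≗ hi≗ (Path-hasIntervalEdges (m * d) (m′ * d) (m + 1) step))

-- Dense sets of tuples contain switching chains

∑-mono-≤ : ∀ {k} {f g : Fin k → ℕ} → (∀ i → f i ≤ g i) → sum f ≤ sum g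
∑-mono-≤ {zero}  _   = z≤n
∑-mono-≤ {suc k} f≤g = +-mono-≤ (f≤g Fin.zero) (∑-mono-≤ (f≤g ∘ Fin.suc))

∑-const : ∀ k c → ∑[ i < k ] c ≡ k * c
∑-const zero    c = refl
∑-const (suc k) c = cong (c +_) (∑-const k c)

indicator : Bool → ℕ
indicator true  = 1
indicator false = 0

∑-indicator≤1 : ∀ {k} (f : Fin k → Bool) → (∀ i j → f i ≡ true → f j ≡ true → i ≡ j) →
  ∑[ i < k ] indicator (f i) ≤ 1
∑-indicator≤1 {zero} f _ = z≤n
∑-indicator≤1 {suc k} f unique with f Fin.zero in f0
... | true = subst (_≤ 1) (cong suc (sym (trans (sum-cong-≗ {k} rest-empty) (trans (∑-const k 0) (*-zeroʳ k))))) ≤-refl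
  where
  rest-empty : ∀ i → indicator (f (Fin.suc i)) ≡ 0
  rest-empty i with f (Fin.suc i) in fi
  ... | true = contradiction (unique Fin.zero (Fin.suc i) f0 fi) λ ()
  ... | false = refl
... | false = ∑-indicator≤1 (f ∘ Fin.suc) (λ i j fi fj → FinP.suc-injective (unique (Fin.suc i) (Fin.suc j) fi fj))

∑-indicator-≟ : ∀ {k} (i : Fin k) → ∑[ j < k ] indicator ⌊ i FinP.≟ j ⌋ ≡ 1
∑-indicator-≟ {suc k} Fin.zero = cong suc (trans (sum-cong-≗ {k} (λ _ → refl)) (trans (∑-const k 0) (*-zeroʳ k)))
∑-indicator-≟ {suc k} (Fin.suc i) = trans (sum-cong-≗ (λ j → cong indicator (suc≟suc i j))) (∑-indicator-≟ i)
  where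
  suc≟suc : ∀ {k} (i j : Fin k) → ⌊ Fin.suc i FinP.≟ Fin.suc j ⌋ ≡ ⌊ i FinP.≟ j ⌋
  suc≟suc i j with i FinP.≟ j
  ... | yes _ = refl
  ... | no _ = refl

∑-indicator≥2⇒other : ∀ {k} (f : Fin k → Bool) → 2 ≤ ∑[ i < k ] indicator (f i) →
  ∀ b → ∃[ i ] (i ≢ b × f i ≡ true)
∑-indicator≥2⇒other f 2≤∑ b with any? (λ i → ¬? (i FinP.≟ b) ×-dec (f i Bool.≟ true))
... | yes other = other
... | no none = contradiction (∑-indicator≤1 f only-b) (<⇒≱ 2≤∑)
  where
  is-b : ∀ i → f i ≡ true → i ≡ b
  is-b i fi with i FinP.≟ b
  ... | yes i≡b = i≡b
  ... | no i≢b = contradiction (i , i≢b , fi) none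
  only-b : ∀ i j → f i ≡ true → f j ≡ true → i ≡ j
  only-b i j fi fj = trans (is-b i fi) (sym (is-b j fj))

switch : ∀ {A : Set} {m} → ℕ → Vec A m → Vec A m → Vec A m
switch zero    a       b       = a
switch (suc j) []      []      = []
switch (suc j) (x ∷ a) (y ∷ b) = y ∷ switch j a b

lookup-switch-< : ∀ {A : Set} {m} j (a b : Vec A m) (i : Fin m) → toℕ i < j → lookup (switch j a b) i ≡ lookup b i
lookup-switch-< (suc j) (x ∷ a) (y ∷ b) Fin.zero    _         = refl
lookup-switch-< (suc j) (x ∷ a) (y ∷ b) (Fin.suc i) (s≤s i<j) = lookup-switch-< j a b i i<j

lookup-switch-≥ : ∀ {A : Set} {m} j (a b : Vec A m) (i : Fin m) → j ≤ toℕ i → lookup (switch j a b) i ≡ lookup a i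
lookup-switch-≥ zero    a       b       i           _         = refl
lookup-switch-≥ (suc j) (x ∷ a) (y ∷ b) (Fin.suc i) (s≤s j≤i) = lookup-switch-≥ j a b i j≤i

module _ (n : ℕ) where

  ∑ᵗ : ∀ m → (Vec (Fin n) m → ℕ) → ℕ
  ∑ᵗ zero    f = f []
  ∑ᵗ (suc m) f = ∑[ x < n ] ∑ᵗ m (f ∘ (x ∷_))

  ∑ᵗ-cong : ∀ m {f g : Vec (Fin n) m → ℕ} → (∀ t → f t ≡ g t) → ∑ᵗ m f ≡ ∑ᵗ m g
  ∑ᵗ-cong zero    f≗g = f≗g []
  ∑ᵗ-cong (suc m) f≗g = sum-cong-≗ {n} (λ x → ∑ᵗ-cong m (f≗g ∘ (x ∷_)))

  ∑ᵗ-distrib-+ : ∀ m (f g : Vec (Fin n) m → ℕ) → ∑ᵗ m (λ t → f t + g t) ≡ ∑ᵗ m f + ∑ᵗ m g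
  ∑ᵗ-distrib-+ zero    f g = refl
  ∑ᵗ-distrib-+ (suc m) f g =
    trans (sum-cong-≗ {n} (λ x → ∑ᵗ-distrib-+ m _ _)) (∑-distrib-+ (λ x → ∑ᵗ m (f ∘ (x ∷_))) (λ x → ∑ᵗ m (g ∘ (x ∷_))))

  ∑ᵗ-mono-≤ : ∀ m {f g : Vec (Fin n) m → ℕ} → (∀ t → f t ≤ g t) → ∑ᵗ m f ≤ ∑ᵗ m g
  ∑ᵗ-mono-≤ zero    f≤g = f≤g []
  ∑ᵗ-mono-≤ (suc m) f≤g = ∑-mono-≤ (λ x → ∑ᵗ-mono-≤ m (f≤g ∘ (x ∷_)))

  ∑ᵗ-const : ∀ m c → ∑ᵗ m (λ _ → c) ≡ n ^ m * c
  ∑ᵗ-const zero    c = sym (+-identityʳ c)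
  ∑ᵗ-const (suc m) c = trans (sum-cong-≗ {n} (λ _ → ∑ᵗ-const m c)) (trans (∑-const n (n ^ m * c)) (sym (*-assoc n (n ^ m) c)))

  ∑-∑ᵗ-comm : ∀ {k} m (g : Fin k → Vec (Fin n) m → ℕ) →
    ∑[ i < k ] ∑ᵗ m (g i) ≡ ∑ᵗ m (λ t → ∑[ i < k ] g i t)
  ∑-∑ᵗ-comm zero    g = refl
  ∑-∑ᵗ-comm (suc m) g = trans (∑-comm (λ i x → ∑ᵗ m (g i ∘ (x ∷_)))) (sum-cong-≗ {n} (λ x → ∑-∑ᵗ-comm m (λ i → g i ∘ (x ∷_))))

  count : ∀ m → (Vec (Fin n) m → Bool) → ℕ
  count m S = ∑ᵗ m (indicator ∘ S)

  columnSize : ∀ {m} → (Vec (Fin n) (suc m) → Bool) → Vec (Fin n) m → ℕ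
  columnSize S t = ∑[ x < n ] indicator (S (x ∷ t))

  rich : ∀ {m} → (Vec (Fin n) (suc m) → Bool) → Fin n → Vec (Fin n) m → Bool
  rich S x t = (2 ≤ᵇ columnSize S t) ∧ S (x ∷ t)

  columnSize≤rich+1 : ∀ {m} (S : Vec (Fin n) (suc m) → Bool) t →
    columnSize S t ≤ ∑[ x < n ] indicator (rich S x t) + 1
  columnSize≤rich+1 S t with 2 ≤ᵇ columnSize S t in rich?
  ... | true  = m≤m+n _ 1
  ... | false = ≤-trans (≤-pred (≰⇒> (λ 2≤ → subst T rich? (≤⇒≤ᵇ 2≤)))) (m≤n+m 1 _)

  count≤rich+n^m : ∀ m (S : Vec (Fin n) (suc m) → Bool) →
    count (suc m) S ≤ ∑[ x < n ] count m (rich S x) + n ^ m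
  count≤rich+n^m m S = begin
    count (suc m) S                                          ≡⟨ ∑-∑ᵗ-comm m (λ x t → indicator (S (x ∷ t))) ⟩
    ∑ᵗ m (columnSize S)                                      ≤⟨ ∑ᵗ-mono-≤ m (columnSize≤rich+1 S) ⟩
    ∑ᵗ m (λ t → ∑[ x < n ] indicator (rich S x t) + 1)       ≡⟨ ∑ᵗ-distrib-+ m _ (λ _ → 1) ⟩
    ∑ᵗ m (λ t → ∑[ x < n ] indicator (rich S x t)) + ∑ᵗ m (λ _ → 1)
                                                             ≡⟨ cong₂ _+_ (sym (∑-∑ᵗ-comm m (λ x t → indicator (rich S x t))))
                                                                          (trans (∑ᵗ-const m 1) (*-identityʳ (n ^ m))) ⟩
    ∑[ x < n ] count m (rich S x) + n ^ m                    ∎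
    where open ≤-Reasoning

  SwitchingChain : ∀ {m} → (Vec (Fin n) m → Bool) → Vec (Fin n) m → Vec (Fin n) m → Set
  SwitchingChain S a b = (∀ i → lookup a i ≢ lookup b i) × (∀ j → S (switch j a b) ≡ true)

  -- If some slice rich S b₁ is still dense, a chain in it starts in a column with a second member
  -- a₁ ≠ b₁; otherwise count≤rich+n^m contradicts the density of S.
  dense⇒switchingChain : ∀ m (S : Vec (Fin n) m → Bool) → m * n ^ m < n * count m S → ∃₂ (SwitchingChain S)
  dense⇒switchingChain zero S dense with S [] in S[]≡true
  ... | true  = [] , [] , (λ ()) , λ { zero → S[]≡true ; (suc _) → S[]≡true }
  ... | false = contradiction (subst (0 <_) (*-zeroʳ n) dense) λ ()
  dense⇒switchingChain (suc m) S dense with any? (λ x → m * n ^ m <? n * count m (rich S x))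
  ... | yes (b₁ , dense-b₁) = prepend (dense⇒switchingChain m (rich S b₁) dense-b₁)
    where
    prepend : ∃₂ (SwitchingChain (rich S b₁)) → ∃₂ (SwitchingChain S)
    prepend (a , b , differ , chain) with ∑-indicator≥2⇒other (λ x → S (x ∷ a))
                                            (≤ᵇ⇒≤ 2 _ (Equivalence.from T-≡ (proj₁ (∧≡true (chain 0))))) b₁
    ... | a₁ , a₁≢b₁ , Sa₁a =
      a₁ ∷ a , b₁ ∷ b , (λ { Fin.zero → a₁≢b₁ ; (Fin.suc i) → differ i }) ,
      λ { zero → Sa₁a ; (suc j) → proj₂ (∧≡true (chain j)) }
  ... | no sparse = contradiction dense (≤⇒≯ sparse-bound)
    where
    rearrange : ∀ n m P → n * (m * P) + n * P ≡ suc m * (n * P)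
    rearrange = solve-∀
    sparse-bound : n * count (suc m) S ≤ suc m * n ^ suc m
    sparse-bound = begin
      n * count (suc m) S                              ≤⟨ *-monoʳ-≤ n (count≤rich+n^m m S) ⟩
      n * (∑[ x < n ] count m (rich S x) + n ^ m)      ≡⟨ *-distribˡ-+ n _ (n ^ m) ⟩
      n * ∑[ x < n ] count m (rich S x) + n * n ^ m    ≡⟨ cong (_+ n * n ^ m) (*-distribˡ-sum n (λ x → count m (rich S x))) ⟩
      ∑[ x < n ] (n * count m (rich S x)) + n * n ^ m  ≤⟨ +-monoˡ-≤ (n * n ^ m) (∑-mono-≤ (λ x → ≮⇒≥ (sparse ∘ (x ,_)))) ⟩
      ∑[ x < n ] (m * n ^ m) + n * n ^ m               ≡⟨ cong (_+ n * n ^ m) (∑-const n (m * n ^ m)) ⟩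
      n * (m * n ^ m) + n * n ^ m                      ≡⟨ rearrange n m (n ^ m) ⟩
      suc m * n ^ suc m                                ∎
      where open ≤-Reasoning

  colourClass : ∀ {m r} → (Vec (Fin n) m → Fin r) → Fin r → Vec (Fin n) m → Bool
  colourClass χ col t = ⌊ χ t FinP.≟ col ⌋

  popularColour : ∀ m r → m * r < n → (χ : Vec (Fin n) m → Fin r) →
    ∃[ col ] (m * n ^ m < n * count m (colourClass χ col))
  popularColour m r mr<n χ with any? (λ col → m * n ^ m <? n * count m (colourClass χ col))
  ... | yes popular = popular
  ... | no none = contradiction mr<n (≤⇒≯ (*-cancelʳ-≤ n (m * r) (n ^ m) {{n^m≢0}} n·n^m≤mr·n^m))
    where
    instance
      n≢0 : NonZero n
      n≢0 = >-nonZero (≤-trans (s≤s z≤n) mr<n)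
    n^m≢0 : NonZero (n ^ m)
    n^m≢0 = m^n≢0 n m
    classes-partition : ∑[ col < r ] count m (colourClass χ col) ≡ n ^ m
    classes-partition = begin
      ∑[ col < r ] count m (colourClass χ col)              ≡⟨ ∑-∑ᵗ-comm m (λ col t → indicator (colourClass χ col t)) ⟩
      ∑ᵗ m (λ t → ∑[ col < r ] indicator (colourClass χ col t)) ≡⟨ ∑ᵗ-cong m (λ t → ∑-indicator-≟ (χ t)) ⟩
      ∑ᵗ m (λ _ → 1)                                         ≡⟨ trans (∑ᵗ-const m 1) (*-identityʳ (n ^ m)) ⟩
      n ^ m                                                  ∎
      where open ≡-Reasoning
    n·n^m≤mr·n^m : n * n ^ m ≤ m * r * n ^ m
    n·n^m≤mr·n^m = begin
      n * n ^ m                                      ≡⟨ cong (n *_) classes-partition ⟨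
      n * ∑[ col < r ] count m (colourClass χ col)   ≡⟨ *-distribˡ-sum n (λ col → count m (colourClass χ col)) ⟩
      ∑[ col < r ] (n * count m (colourClass χ col)) ≤⟨ ∑-mono-≤ (λ col → ≮⇒≥ (none ∘ (col ,_))) ⟩
      ∑[ col < r ] (m * n ^ m)                       ≡⟨ ∑-const r (m * n ^ m) ⟩
      r * (m * n ^ m)                                ≡⟨ rearrange r m (n ^ m) ⟩
      m * r * n ^ m                                  ∎
      where
      open ≤-Reasoning
      rearrange : ∀ r m P → r * (m * P) ≡ m * r * P
      rearrange = solve-∀

  -- The complete m-partite m-graph

  tuple : ∀ {m} → Fin (n ^ m) → Vec (Fin n) m
  tuple i = tabulate (finToFun i)

  index : ∀ {m} → Vec (Fin n) m → Fin (n ^ m)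
  index t = funToFin (lookup t)

  tuple-index : ∀ {m} (t : Vec (Fin n) m) → tuple (index t) ≡ t
  tuple-index t = trans (tabulate-cong (finToFun-funToFin (lookup t))) (tabulate∘lookup t)

  tuple-injective : ∀ {m} → Injective _≡_ _≡_ (tuple {m})
  tuple-injective {m} {i} {j} eq = begin
    i          ≡⟨ funToFin-finToFin {m} {n} i ⟨
    funToFin f ≡⟨ funToFin-cong f≗g ⟩
    funToFin g ≡⟨ funToFin-finToFin {m} {n} j ⟩
    j          ∎
    where
    open ≡-Reasoning
    f g : Fin m → Fin n
    f = finToFun i
    g = finToFun j
    f≗g : ∀ k → f k ≡ g k
    f≗g k = trans (sym (lookup∘tabulate f k)) (trans (cong (λ t → lookup t k) eq) (lookup∘tabulate g k))

  transversal : ∀ {m} → Vec (Fin n) m → Subset (m * n)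
  transversal []      = []
  transversal (x ∷ t) = ⁅ x ⁆ ++ transversal t

  combine∈transversal⇔ : ∀ {m} (t : Vec (Fin n) m) i z → combine i z ∈ transversal t ⇔ z ≡ lookup t i
  combine∈transversal⇔ (x ∷ t) Fin.zero z = ⇔-trans (∈-cong-lookup (lookup-++ˡ ⁅ x ⁆ (transversal t) z)) x∈⁅y⁆⇔x≡y
  combine∈transversal⇔ (x ∷ t) (Fin.suc i) z =
    ⇔-trans (∈-cong-lookup (lookup-++ʳ ⁅ x ⁆ (transversal t) (combine i z))) (combine∈transversal⇔ t i z)

  ∣transversal∣ : ∀ {m} (t : Vec (Fin n) m) → ∣ transversal t ∣ ≡ m
  ∣transversal∣ []      = refl
  ∣transversal∣ (x ∷ t) = trans (∣p++q∣≡∣p∣+∣q∣ ⁅ x ⁆ (transversal t)) (cong₂ _+_ (∣⁅x⁆∣≡1 x) (∣transversal∣ t))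

  transversal-injective : ∀ {m} → Injective _≡_ _≡_ (transversal {m})
  transversal-injective {x = []}    {[]}    _  = refl
  transversal-injective {x = x ∷ s} {y ∷ t} eq = cong₂ _∷_
    (x∈⁅y⁆⇒x≡y y (subst (x ∈_) (++-injectiveˡ ⁅ x ⁆ ⁅ y ⁆ eq) (x∈⁅x⁆ x)))
    (transversal-injective (++-injectiveʳ ⁅ x ⁆ ⁅ y ⁆ eq))

  completePartite : ℕ → Hypergraph
  completePartite m = record { nV = m * n ; nE = n ^ m ; edge = λ i → transversal (tuple {m} i) }

  completePartite-isKGraph : ∀ m → IsKGraph m (completePartite m)
  completePartite-isKGraph m = (λ i → ∣transversal∣ (tuple {m} i)) , (λ i j eq → tuple-injective {m} (transversal-injective {m} eq))

  -- The first m vertices of the tight path go to the transversal a and the last m to b,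
  -- so that its edge e goes to the transversal switch e a b.
  module TightPathCopy {m′ : ℕ} (a b : Vec (Fin n) (suc m′)) (differ : ∀ i → lookup a i ≢ lookup b i) where

    private
      m = suc m′
      P = Path m m′ (m + 1)

      unit-step : m ∸ m′ ≡ 1
      unit-step = m+n∸n≡m 1 m′

      nT≡m+m : nV P ≡ m + m
      nT≡m+m = cong (m +_) (trans (cong ((m + 1 ∸ 1) *_) unit-step) (trans (*-identityʳ _) (m+n∸n≡m m 1)))

      P-intervals : HasIntervalEdges (edge P) toℕ (λ e → toℕ e + m)
      P-intervals = HasIntervalEdges-cong (λ e → *-identityʳ (toℕ e)) (λ e → cong (_+ m) (*-identityʳ (toℕ e)))
        (Path-hasIntervalEdges m m′ (m + 1) unit-step)

    unpack : Fin (nV P) → Fin m ⊎ Fin m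
    unpack y = splitAt m (cast nT≡m+m y)

    pack : Fin m ⊎ Fin m → Fin (nV P)
    pack s = cast (sym nT≡m+m) (join m m s)

    unpack-pack : ∀ s → unpack (pack s) ≡ s
    unpack-pack s = trans (cong (splitAt m) (cast-involutive nT≡m+m (sym nT≡m+m) (join m m s))) (splitAt-join m m s)

    pack-unpack : ∀ y → pack (unpack y) ≡ y
    pack-unpack y = trans (cong (cast (sym nT≡m+m)) (join-splitAt m m (cast nT≡m+m y))) (cast-involutive (sym nT≡m+m) nT≡m+m y)

    position : Fin m ⊎ Fin m → ℕ
    position (inj₁ i) = toℕ i
    position (inj₂ i) = m + toℕ i

    toℕ-pack : ∀ s → toℕ (pack s) ≡ position s
    toℕ-pack (inj₁ i) = trans (toℕ-cast (sym nT≡m+m) (i ↑ˡ m)) (toℕ-↑ˡ i m)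
    toℕ-pack (inj₂ i) = trans (toℕ-cast (sym nT≡m+m) (m ↑ʳ i)) (toℕ-↑ʳ m i)

    Side : ℕ → Fin m ⊎ Fin m → Set
    Side j (inj₁ i) = j ≤ toℕ i
    Side j (inj₂ i) = toℕ i < j

    interval⇔side : ∀ (e : Fin (m + 1)) s → (toℕ e ≤ position s × position s < toℕ e + m) ⇔ Side (toℕ e) s
    interval⇔side e (inj₁ i) = mk⇔ proj₁ (λ e≤i → e≤i , <-≤-trans (toℕ<n i) (m≤n+m m (toℕ e)))
    interval⇔side e (inj₂ i) = mk⇔
      (λ (_ , m+i<e+m) → +-cancelˡ-< m _ _ (subst (m + toℕ i <_) (+-comm (toℕ e) m) m+i<e+m))
      (λ i<e → ≤-trans (toℕ≤n e) (m≤m+n m _) , subst (m + toℕ i <_) (+-comm m (toℕ e)) (+-monoʳ-< m i<e))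

    pack∈⇔ : ∀ e s → pack s ∈ edge P e ⇔ Side (toℕ e) s
    pack∈⇔ e s = ⇔-trans (P-intervals e (pack s))
      (subst (λ p → (toℕ e ≤ p × p < toℕ e + m) ⇔ Side (toℕ e) s) (sym (toℕ-pack s)) (interval⇔side e s))

    vertex : Fin m ⊎ Fin m → Fin (m * n)
    vertex (inj₁ i) = combine i (lookup a i)
    vertex (inj₂ i) = combine i (lookup b i)

    vertex-injective : Injective _≡_ _≡_ vertex
    vertex-injective {inj₁ i} {inj₁ i′} eq = cong inj₁ (proj₁ (combine-injective i _ i′ _ eq))
    vertex-injective {inj₁ i} {inj₂ i′} eq with combine-injective i _ i′ _ eq
    ... | refl , ai≡bi = contradiction ai≡bi (differ i)
    vertex-injective {inj₂ i} {inj₁ i′} eq with combine-injective i _ i′ _ eq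
    ... | refl , bi≡ai = contradiction (sym bi≡ai) (differ i)
    vertex-injective {inj₂ i} {inj₂ i′} eq = cong inj₂ (proj₁ (combine-injective i _ i′ _ eq))

    vertex∈⇔ : ∀ j s → vertex s ∈ transversal (switch j a b) ⇔ Side j s
    vertex∈⇔ j (inj₁ i) = ⇔-trans (combine∈transversal⇔ (switch j a b) i (lookup a i)) (mk⇔ to from)
      where
      to : lookup a i ≡ lookup (switch j a b) i → j ≤ toℕ i
      to ai≡ with j ≤? toℕ i
      ... | yes j≤i = j≤i
      ... | no j≰i = contradiction (trans ai≡ (lookup-switch-< j a b i (≰⇒> j≰i))) (differ i)
      from : j ≤ toℕ i → lookup a i ≡ lookup (switch j a b) i
      from j≤i = sym (lookup-switch-≥ j a b i j≤i)
    vertex∈⇔ j (inj₂ i) = ⇔-trans (combine∈transversal⇔ (switch j a b) i (lookup b i)) (mk⇔ to from)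
      where
      to : lookup b i ≡ lookup (switch j a b) i → toℕ i < j
      to bi≡ with toℕ i <? j
      ... | yes i<j = i<j
      ... | no i≮j = contradiction (sym (trans bi≡ (lookup-switch-≥ j a b i (≮⇒≥ i≮j)))) (differ i)
      from : toℕ i < j → lookup b i ≡ lookup (switch j a b) i
      from i<j = sym (lookup-switch-< j a b i i<j)

    switch-vertex : ∀ j i → ∃[ s ] (Side j s × vertex s ≡ combine i (lookup (switch j a b) i))
    switch-vertex j i with toℕ i <? j
    ... | yes i<j = inj₂ i , i<j , cong (combine i) (sym (lookup-switch-< j a b i i<j))
    ... | no i≮j = inj₁ i , ≮⇒≥ i≮j , cong (combine i) (sym (lookup-switch-≥ j a b i (≮⇒≥ i≮j)))

    pathVertex : Fin (nV P) → Fin (m * n)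
    pathVertex = vertex ∘ unpack

    pathVertex-injective : Injective _≡_ _≡_ pathVertex
    pathVertex-injective {y} {y′} eq =
      trans (sym (pack-unpack y)) (trans (cong pack (vertex-injective {unpack y} {unpack y′} eq)) (pack-unpack y′))

    pathVertex-mapsOnto : ∀ e → MapsOnto pathVertex (edge P e) (transversal (switch (toℕ e) a b))
    pathVertex-mapsOnto e x = mk⇔ to from
      where
      i = proj₁ (remQuot {m} n x)
      z = proj₂ (remQuot {m} n x)
      combine-i-z≡x : combine i z ≡ x
      combine-i-z≡x = combine-remQuot {m} n x
      to : x ∈ transversal (switch (toℕ e) a b) → ∃[ y ] (y ∈ edge P e × pathVertex y ≡ x)
      to x∈ with switch-vertex (toℕ e) i
      ... | s , side , vertex-s≡ =
        pack s , Equivalence.from (pack∈⇔ e s) side ,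
        trans (cong vertex (unpack-pack s)) (trans vertex-s≡ (trans (cong (combine i) (sym z≡)) combine-i-z≡x))
        where
        z≡ : z ≡ lookup (switch (toℕ e) a b) i
        z≡ = Equivalence.to (combine∈transversal⇔ (switch (toℕ e) a b) i z)
          (subst (_∈ transversal (switch (toℕ e) a b)) (sym combine-i-z≡x) x∈)
      from : ∃[ y ] (y ∈ edge P e × pathVertex y ≡ x) → x ∈ transversal (switch (toℕ e) a b)
      from (y , y∈ , refl) = Equivalence.from (vertex∈⇔ (toℕ e) (unpack y))
        (Equivalence.to (pack∈⇔ e (unpack y)) (subst (_∈ edge P e) (sym (pack-unpack y)) y∈))

  completePartite-arrows : ∀ r m′ → suc m′ * r < n → Arrows r (completePartite (suc m′)) (Path (suc m′) m′ (suc m′ + 1))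
  completePartite-arrows r m′ mr<n c with popularColour (suc m′) r mr<n (c ∘ index)
  ... | col , dense with dense⇒switchingChain (suc m′) (colourClass (c ∘ index) col) dense
  ... | a , b , differ , chain =
    pathVertex , pathVertex-injective , ψ ,
    (λ e → subst (λ t → MapsOnto pathVertex (edge (Path (suc m′) m′ (suc m′ + 1)) e) (transversal t))
                 (sym (tuple-index (switch (toℕ e) a b))) (pathVertex-mapsOnto e)) ,
    λ e e′ → trans (coloured e) (sym (coloured e′))
    where
    open TightPathCopy a b differ
    ψ : Fin (suc m′ + 1) → Fin (n ^ suc m′)
    ψ e = index (switch (toℕ e) a b)
    coloured : ∀ e → c (ψ e) ≡ col
    coloured e = toWitness (Equivalence.from T-≡ (chain (toℕ e)))

n/1≡mkℚ : ∀ n → (ℤ.+ n / 1) ≡ mkℚ (ℤ.+ n) 0 (Coprime.sym (1-coprimeTo n))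
n/1≡mkℚ n = ℚ.normalize-coprime (Coprime.sym (1-coprimeTo n))

n/1-mono-≤ : ∀ {m n} → m ≤ n → (ℤ.+ m / 1) ℚ.≤ (ℤ.+ n / 1)
n/1-mono-≤ {m} {n} m≤n rewrite n/1≡mkℚ m | n/1≡mkℚ n =
  ℚ.*≤* (subst₂ ℤ._≤_ (sym (ℤ.*-identityʳ (ℤ.+ m))) (sym (ℤ.*-identityʳ (ℤ.+ n))) (ℤ.+≤+ m≤n))

1≤expApprox₀ : ∀ m → ℚ.1ℚ ℚ.≤ expApprox m 0
1≤expApprox₀ m = subst (ℚ.1ℚ ℚ.≤_) (sym expApprox₀≡2^m) (n/1-mono-≤ (m^n>0 2 (1 * m)))
  where
  expApprox₀≡2^m : expApprox m 0 ≡ (ℤ.+ (2 ^ (1 * m)) / 1)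
  expApprox₀≡2^m = ℚ./-cong {p₁ = ℤ.+ (2 ^ (1 * m))} {q₁ = 1 ^ (1 * m)} {q₂ = 1} {{m^n≢0 1 (1 * m)}} refl (^-zeroˡ (1 * m))

-- The approximation expApprox m 0 = 2^m ≥ 1 of e^m already suffices.
≤⇒≤c·e^ : ∀ m {E c} → E ≤ c → ≤c·e^ E c m
≤⇒≤c·e^ m {E} {c} E≤c ε 0<ε = 0 , (begin
  ℤ.+ E / 1                           ≤⟨ n/1-mono-≤ E≤c ⟩
  ℤ.+ c / 1                           ≡⟨ ℚ.*-identityʳ (ℤ.+ c / 1) ⟨
  ℤ.+ c / 1 ℚ.* ℚ.1ℚ                  ≤⟨ ℚ.*-monoˡ-≤-nonNeg (ℤ.+ c / 1) {{ℚ.normalize-nonNeg c 1}} (1≤expApprox₀ m) ⟩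
  ℤ.+ c / 1 ℚ.* expApprox m 0         ≡⟨ ℚ.+-identityʳ _ ⟨
  ℤ.+ c / 1 ℚ.* expApprox m 0 ℚ.+ ℚ.0ℚ ≤⟨ ℚ.+-monoʳ-≤ (ℤ.+ c / 1 ℚ.* expApprox m 0) (ℚ.<⇒≤ 0<ε) ⟩
  ℤ.+ c / 1 ℚ.* expApprox m 0 ℚ.+ ε   ∎)
  where open ℚ.≤-Reasoning

SizeRamsey≤-weaken : ∀ {r k H N N′} → N ≤ N′ → SizeRamsey≤ r k H N → SizeRamsey≤ r k H N′
SizeRamsey≤-weaken N≤N′ (G , G-isK , E≤N , G→H) = G , G-isK , ≤-trans E≤N N≤N′ , G→H

SizeRamsey≤-mono : ∀ {r k k′ H H′ N} → SizeRamseyMono r k H k′ H′ → SizeRamsey≤ r k′ H′ N → SizeRamsey≤ r k H N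
SizeRamsey≤-mono mono (G , G-isK , E≤N , G→H′) with mono G G-isK G→H′
... | G′ , G′-isK , E′≤E , G′→H = G′ , G′-isK , ≤-trans E′≤E E≤N , G′→H

SizeRamsey≤⇒SizeRamsey≤e : ∀ {r k H N} c m → N ≤ c ^ m → SizeRamsey≤ r k H N → SizeRamsey≤e r k H c m
SizeRamsey≤⇒SizeRamsey≤e c m N≤cᵐ (G , G-isK , E≤N , G→H) = G , G-isK , G→H , ≤⇒≤c·e^ m (≤-trans E≤N N≤cᵐ)

tightPath-sizeRamsey≤ : ∀ r m → 1 ≤ m → SizeRamsey≤ r m (Path m (m ∸ 1) (m + 1)) (suc (m * r) ^ m)
tightPath-sizeRamsey≤ r m@(suc m′) _ =
  completePartite n m , completePartite-isKGraph n m , ≤-refl , completePartite-arrows n r m′ ≤-refl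
  where
  n = suc (m * r)

1+mr≤[m+1]r : ∀ m {r} → 1 ≤ r → suc (m * r) ≤ (m + 1) * r
1+mr≤[m+1]r m {r} 1≤r = begin
  suc (m * r) ≡⟨ +-comm 1 (m * r) ⟩
  m * r + 1   ≤⟨ +-monoʳ-≤ (m * r) 1≤r ⟩
  m * r + r   ≡⟨ cong (m * r +_) (*-identityˡ r) ⟨
  m * r + 1 * r ≡⟨ *-distribʳ-+ r m 1 ⟨
  (m + 1) * r ∎
  where open ≤-Reasoning

tightPath-sizeRamsey≤e : ∀ r m → 1 ≤ r → 1 ≤ m → SizeRamsey≤e r m (Path m (m ∸ 1) (m + 1)) ((m + 1) * r) m
tightPath-sizeRamsey≤e r m 1≤r 1≤m =
  SizeRamsey≤⇒SizeRamsey≤e ((m + 1) * r) m (^-monoˡ-≤ m (1+mr≤[m+1]r m 1≤r)) (tightPath-sizeRamsey≤ r m 1≤m)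

Path₂-upperBound : ∀ r k ℓ → 1 ≤ ℓ → ℓ < k → SizeRamsey≤ r k (Path k ℓ 2) (r + 1)
Path₂-upperBound r k ℓ 1≤ℓ ℓ<k =
  SizeRamsey≤-mono (sizeRamseyMono-extend r k ℓ 1 ≤-refl D<k)
    (SizeRamsey≤-mono (sizeRamseyMono-blowUp r 1 D ≤-refl (m<n⇒0<n∸m ℓ<k))
      (SizeRamsey≤-weaken (≤-reflexive [1+r]¹≡r+1) (tightPath-sizeRamsey≤ r 1 ≤-refl)))
  where
  D = k ∸ ℓ
  D<k : 1 * D < k
  D<k = subst (_< k) (sym (*-identityˡ D)) (∸-monoʳ-< 1≤ℓ (<⇒≤ ℓ<k))
  [1+r]¹≡r+1 : suc (1 * r) ^ 1 ≡ r + 1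
  [1+r]¹≡r+1 = trans (*-identityʳ (suc (1 * r))) (trans (cong suc (*-identityˡ r)) (+-comm 1 r))

Path₂-lowerBound : ∀ r k ℓ → ℓ < k → SizeRamsey≥ r k (Path k ℓ 2) (r + 1)
Path₂-lowerBound r k ℓ ℓ<k G _ G→P with r + 1 ≤? nE G
... | yes r+1≤E = r+1≤E
... | no r+1≰E = contradiction (G→P rainbow) no-rainbow-copy
  where
  rainbow : Colouring r G
  rainbow i = inject≤ i (≤-pred (subst (suc (nE G) ≤_) (+-comm r 1) (≰⇒> r+1≰E)))
  first second : Fin 2
  first = Fin.zero
  second = Fin.suc Fin.zero
  0<k : 0 < k
  0<k = ≤-trans (s≤s z≤n) ℓ<k
  v₀ : Fin (nV (Path k ℓ 2))
  v₀ = fromℕ< (≤-trans 0<k (m≤m+n k _))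
  v₀∈first : v₀ ∈ edge (Path k ℓ 2) first
  v₀∈first = Equivalence.from (Path-hasIntervalEdges k ℓ 2 refl first v₀)
    (z≤n , subst (_< k) (sym (toℕ-fromℕ< _)) 0<k)
  no-rainbow-copy : ¬ MonoCopy G (Path k ℓ 2) rainbow
  no-rainbow-copy (φ , φ-inj , ψ , ψ-edges , mono) = <⇒≱ (m<n⇒0<n∸m ℓ<k) D≤0
    where
    same-edge : ψ first ≡ ψ second
    same-edge = inject≤-injective _ _ _ _ (mono first second)
    φv₀∈second : φ v₀ ∈ edge G (ψ second)
    φv₀∈second = subst (λ i → φ v₀ ∈ edge G i) same-edge
      (Equivalence.from (ψ-edges first (φ v₀)) (v₀ , v₀∈first , refl))
    D≤0 : k ∸ ℓ ≤ 0
    D≤0 with Equivalence.to (ψ-edges second (φ v₀)) φv₀∈second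
    ... | y , y∈second , φy≡φv₀ = subst₂ _≤_ (+-identityʳ (k ∸ ℓ)) (trans (cong toℕ (φ-inj φy≡φv₀)) (toℕ-fromℕ< _))
      (proj₁ (Equivalence.to (Path-hasIntervalEdges k ℓ 2 refl second y) y∈second))

lemma4p2 : ∀ (r k ℓ : ℕ) → 2 ≤ r → 1 ≤ ℓ → ℓ < k →
    (∀ (m : ℕ) → 1 ≤ m → m * (k ∸ ℓ) < k →
      SizeRamseyMono r k (Path k ℓ (m + 1)) (m * (k ∸ ℓ)) (Path (m * (k ∸ ℓ)) ((m ∸ 1) * (k ∸ ℓ)) (m + 1))
      × SizeRamseyMono r (m * (k ∸ ℓ)) (Path (m * (k ∸ ℓ)) ((m ∸ 1) * (k ∸ ℓ)) (m + 1)) m (Path m (m ∸ 1) (m + 1))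
      × SizeRamsey≤e r m (Path m (m ∸ 1) (m + 1)) ((m + 1) * r) m)
    × (SizeRamsey≤ r k (Path k ℓ 2) (r + 1) × SizeRamsey≥ r k (Path k ℓ 2) (r + 1))
lemma4p2 r k ℓ 2≤r 1≤ℓ ℓ<k =
  (λ m 1≤m mD<k →
    sizeRamseyMono-extend r k ℓ m 1≤m mD<k ,
    sizeRamseyMono-blowUp r m (k ∸ ℓ) 1≤m (m<n⇒0<n∸m ℓ<k) ,
    tightPath-sizeRamsey≤e r m (≤-trans (s≤s z≤n) 2≤r) 1≤m) ,
  Path₂-upperBound r k ℓ 1≤ℓ ℓ<k ,
  Path₂-lowerBound r k ℓ ℓ<k
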